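{- Let $G$ be an unweighted graph (parallel edges allowed, no self-loops) on $n\geq 2$ vertices whose minimum cut value is $k\ge1$, and suppose there is no vertex set $S$ with $|S|\ge2$ such that the induced subgraph $G[S]$ has minimum cut value at least $2k$. Then $G$ has $\Theta(nk)$ edges.
   Context: The minimum cut value (strong connectivity) of a graph is the minimum, over bipartitions of its vertex set into two nonempty parts, of the number of edges between the parts. $G[S]$ denotes the vertex-induced subgraph on $S$. -}

module Defs where

open import Data.Nat using (ℕ; zero; suc; _+_; _≤_)
open import Data.Bool using (Bool; true; false; _∧_; _xor_; not; if_then_else_)
open import Data.Fin using (Fin)
open import Data.List using (List; []; _∷_; length; allFin)
open import Data.List.Relation.Unary.All using (All)
open import Data.Product using (_×_; _,_; proj₁; proj₂; ∃-syntax)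
open import Relation.Binary.PropositionalEquality using (_≡_; _≢_)

-- A finite loopless multigraph on vertex set Fin n: a list of edges
-- (parallel edges allowed = repeated entries), no self-loops.
record Multigraph (n : ℕ) : Set where
  field
    edges    : List (Fin n × Fin n)
    loopless : All (λ e → proj₁ e ≢ proj₂ e) edges

open Multigraph public

numEdges : ∀ {n} → Multigraph n → ℕ
numEdges G = length (edges G)

VSet : ℕ → Set
VSet n = Fin n → Bool

count : ∀ {A : Set} → (A → Bool) → List A → ℕ
count p []       = 0
count p (x ∷ xs) = if p x then suc (count p xs) else count p xs

size : ∀ {n} → VSet n → ℕ
size {n} S = count S (allFin n)

full : ∀ {n} → VSet n
full _ = true

IsBipartition : ∀ {n} → VSet n → VSet n → Set
IsBipartition S T = (∃[ v ] (S v ∧ T v ≡ true)) × (∃[ v ] (S v ∧ not (T v) ≡ true))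

cutIn : ∀ {n} → Multigraph n → VSet n → VSet n → ℕ
cutIn G S T = count (λ e → S (proj₁ e) ∧ S (proj₂ e) ∧ (T (proj₁ e) xor T (proj₂ e))) (edges G)

MinCutAtLeast : ∀ {n} → Multigraph n → VSet n → ℕ → Set
MinCutAtLeast G S m = ∀ T → IsBipartition S T → m ≤ cutIn G S T

MinCutValue : ∀ {n} → Multigraph n → ℕ → Set
MinCutValue G k = MinCutAtLeast G full k × (∃[ T ] (IsBipartition full T × cutIn G full T ≡ k))

module Submission where

-- Lower bound (handshake lemma): each vertex v forms one side of a bipartition
-- of V, so its degree is at least k; the degrees sum to 2m, hence nk ≤ 2m.
--
-- Upper bound (sparsity): if no G[S] with |S| ≥ 2 has minimum cut ≥ c, then
-- every nonempty S spans at most c(|S| − 1) edges.  By induction on |S|: a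
-- bipartition (S₁, S₂) of S cutting fewer than c edges of G[S] gives
-- e(S) = e(S₁) + e(S₂) + cut ≤ c(|S₁| − 1) + c(|S₂| − 1) + c.  Finding such a
-- bipartition needs no search: the bound is decidable, so it suffices to show
-- that its failure would make every cut of G[S] at least c.
-- With c = 2k and S = V this gives m ≤ 2k(n − 1) ≤ 2nk.

open import Defs
open import Data.Nat using (ℕ; zero; suc; _+_; _*_; _≤_; _≤?_; z≤n; s≤s)
open import Data.Nat.Properties hiding (_≟_)
open import Data.Nat.Tactic.RingSolver using (solve-∀)
open import Data.Bool using (Bool; true; false; _∧_; _xor_; not)
open import Data.Fin using (Fin; _≟_)
open import Data.List using (List; []; _∷_; length; allFin)
open import Data.List.Properties using (length-tabulate)
open import Data.List.Relation.Unary.All as All using (All; []; _∷_)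
open import Data.List.Relation.Unary.Any using (here; there)
open import Data.List.Membership.Propositional using (_∈_)
open import Data.List.Membership.Propositional.Properties using (∈-allFin)
open import Data.Product using (_×_; ∃-syntax; _,_; proj₁; proj₂)
open import Function using (id)
open import Relation.Nullary using (¬_; Dec; yes; no; does; contradiction)
open import Relation.Nullary.Decidable using (decidable-stable; dec-true)
open import Relation.Binary.PropositionalEquality
open import Algebra.Properties.CommutativeMonoid.Sum +-0-commutativeMonoid
  using (sum; sum-syntax; sum-cong-≗; ∑-distrib-+)

ind : Bool → ℕ
ind true  = 1
ind false = 0

count-∷ : ∀ {A : Set} (p : A → Bool) x xs → count p (x ∷ xs) ≡ ind (p x) + count p xs
count-∷ p x xs with p x
... | true  = refl
... | false = refl

count-additive : ∀ {A : Set} (p q r : A → Bool) → (∀ x → ind (p x) ≡ ind (q x) + ind (r x))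
               → ∀ xs → count p xs ≡ count q xs + count r xs
count-additive p q r split [] = refl
count-additive p q r split (x ∷ xs) = begin
  count p (x ∷ xs)                                          ≡⟨ count-∷ p x xs ⟩
  ind (p x) + count p xs                                    ≡⟨ cong₂ _+_ (split x) (count-additive p q r split xs) ⟩
  (ind (q x) + ind (r x)) + (count q xs + count r xs)       ≡⟨ +-interchange (ind (q x)) (ind (r x)) (count q xs) (count r xs) ⟩
  (ind (q x) + count q xs) + (ind (r x) + count r xs)       ≡⟨ sym (cong₂ _+_ (count-∷ q x xs) (count-∷ r x xs)) ⟩
  count q (x ∷ xs) + count r (x ∷ xs)                       ∎
  where
  open ≡-Reasoning
  +-interchange : ∀ a b c d → (a + b) + (c + d) ≡ (a + c) + (b + d)
  +-interchange = solve-∀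

count-true : ∀ {A : Set} (xs : List A) → count (λ _ → true) xs ≡ length xs
count-true []       = refl
count-true (_ ∷ xs) = cong suc (count-true xs)

count-none : ∀ {A : Set} (p : A → Bool) {xs} → All (λ x → p x ≡ false) xs → count p xs ≡ 0
count-none p []                       = refl
count-none p {x ∷ xs} (px≡false ∷ rest) rewrite px≡false = count-none p rest

count-pos : ∀ {A : Set} (p : A → Bool) {x xs} → x ∈ xs → p x ≡ true → 1 ≤ count p xs
count-pos p {x} {y ∷ ys} (here refl) px rewrite count-∷ p y ys | px = s≤s z≤n
count-pos p {x} {y ∷ ys} (there x∈ys) px rewrite count-∷ p y ys =
  ≤-trans (count-pos p x∈ys px) (m≤n+m _ _)

_∩_ : ∀ {n} → VSet n → VSet n → VSet n
(S ∩ T) v = S v ∧ T v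

_∖_ : ∀ {n} → VSet n → VSet n → VSet n
(S ∖ T) v = S v ∧ not (T v)

singleton : ∀ {n} → Fin n → VSet n
singleton v u = does (u ≟ v)

size-full : ∀ n → size {n} full ≡ n
size-full n = trans (count-true (allFin n)) (length-tabulate id)

size-pos : ∀ {n} (S : VSet n) {v} → S v ≡ true → 1 ≤ size S
size-pos S {v} v∈S = count-pos S (∈-allFin v) v∈S

size-split : ∀ {n} (S T : VSet n) → size S ≡ size (S ∩ T) + size (S ∖ T)
size-split {n} S T = count-additive S (S ∩ T) (S ∖ T) (λ v → table (S v) (T v)) (allFin n)
  where
  table : ∀ a b → ind a ≡ ind (a ∧ b) + ind (a ∧ not b)
  table true  true  = refl
  table true  false = refl
  table false _     = refl

two-members : ∀ {n} (S : VSet n) {a b} → S a ≡ true → S b ≡ true → a ≢ b → 2 ≤ size S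
two-members S {a} {b} a∈S b∈S a≢b rewrite size-split S (singleton a) =
  +-mono-≤ (size-pos (S ∩ singleton a) {a} (cong₂ _∧_ a∈S (dec-true (a ≟ a) refl)))
           (size-pos (S ∖ singleton a) {b} (cong₂ _∧_ b∈S (cong not b∉a)))
  where
  b∉a : does (b ≟ a) ≡ false
  b∉a with b ≟ a
  ... | yes b≡a = contradiction (sym b≡a) a≢b
  ... | no _    = refl

part-smaller : ∀ {a b N} → 1 ≤ b → a + b ≤ suc N → a ≤ N
part-smaller {a} 1≤b a+b≤1+N = ≤-pred (<-≤-trans (m<m+n a 1≤b) a+b≤1+N)

edgesIn : ∀ {n} → Multigraph n → VSet n → ℕ
edgesIn G S = count (λ e → S (proj₁ e) ∧ S (proj₂ e)) (edges G)

edgesIn-full : ∀ {n} (G : Multigraph n) → edgesIn G full ≡ numEdges G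
edgesIn-full G = count-true (edges G)

edgesIn-split : ∀ {n} (G : Multigraph n) (S T : VSet n) →
  edgesIn G S ≡ edgesIn G (S ∩ T) + edgesIn G (S ∖ T) + cutIn G S T
edgesIn-split G S T = begin
  edgesIn G S                                         ≡⟨ count-additive _ uncut _ (λ e → crossing (S (proj₁ e)) (S (proj₂ e)) (xor-ends e)) (edges G) ⟩
  count uncut (edges G) + cutIn G S T                 ≡⟨ cong (_+ cutIn G S T) (count-additive uncut _ _ (λ e → sides (S (proj₁ e)) (S (proj₂ e)) (T (proj₁ e)) (T (proj₂ e))) (edges G)) ⟩
  edgesIn G (S ∩ T) + edgesIn G (S ∖ T) + cutIn G S T ∎
  where
  open ≡-Reasoning
  xor-ends : Fin _ × Fin _ → Bool
  xor-ends e = T (proj₁ e) xor T (proj₂ e)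
  uncut : Fin _ × Fin _ → Bool
  uncut e = S (proj₁ e) ∧ S (proj₂ e) ∧ not (xor-ends e)
  crossing : ∀ a b x → ind (a ∧ b) ≡ ind (a ∧ b ∧ not x) + ind (a ∧ b ∧ x)
  crossing false _     _     = refl
  crossing true  false _     = refl
  crossing true  true  true  = refl
  crossing true  true  false = refl
  sides : ∀ a b c d → ind (a ∧ b ∧ not (c xor d)) ≡ ind ((a ∧ c) ∧ (b ∧ d)) + ind ((a ∧ not c) ∧ (b ∧ not d))
  sides false _     _     _     = refl
  sides true  false true  _     = refl
  sides true  false false _     = refl
  sides true  true  true  true  = refl
  sides true  true  true  false = refl
  sides true  true  false true  = refl
  sides true  true  false false = refl

edgesIn-≤1 : ∀ {n} (G : Multigraph n) (S : VSet n) → size S ≤ 1 → edgesIn G S ≡ 0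
edgesIn-≤1 G S |S|≤1 = count-none _ (All.map not-inside (loopless G))
  where
  not-inside : ∀ {e} → proj₁ e ≢ proj₂ e → S (proj₁ e) ∧ S (proj₂ e) ≡ false
  not-inside {u , v} u≢v with S u in u∈S | S v in v∈S
  ... | true  | true  = contradiction (≤-trans (two-members S u∈S v∈S u≢v) |S|≤1) λ { (s≤s ()) }
  ... | true  | false = refl
  ... | false | _     = refl

-- The sparsity bound e(S) ≤ c(|S| − 1), written without subtraction.
Sparse : ∀ {n} → Multigraph n → ℕ → VSet n → Set
Sparse G c S = edgesIn G S + c ≤ c * size S

sparse-glue : ∀ {n} (G : Multigraph n) c (S T : VSet n) → cutIn G S T ≤ c
            → Sparse G c (S ∩ T) → Sparse G c (S ∖ T) → Sparse G c S
sparse-glue G c S T cut≤c sparse₁ sparse₂ = begin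
  edgesIn G S + c                   ≡⟨ cong (_+ c) (edgesIn-split G S T) ⟩
  e₁ + e₂ + cutIn G S T + c         ≤⟨ +-monoˡ-≤ c (+-monoʳ-≤ (e₁ + e₂) cut≤c) ⟩
  e₁ + e₂ + c + c                   ≡⟨ regroup e₁ e₂ c ⟩
  (e₁ + c) + (e₂ + c)               ≤⟨ +-mono-≤ sparse₁ sparse₂ ⟩
  c * size (S ∩ T) + c * size (S ∖ T) ≡⟨ sym (*-distribˡ-+ c _ _) ⟩
  c * (size (S ∩ T) + size (S ∖ T)) ≡⟨ cong (c *_) (sym (size-split S T)) ⟩
  c * size S                        ∎
  where
  open ≤-Reasoning
  e₁ e₂ : ℕ
  e₁ = edgesIn G (S ∩ T)
  e₂ = edgesIn G (S ∖ T)
  regroup : ∀ a b c → a + b + c + c ≡ (a + c) + (b + c)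
  regroup = solve-∀

sparse-all : ∀ {n} (G : Multigraph n) c →
             (∀ (S : VSet n) → 2 ≤ size S → ¬ MinCutAtLeast G S c) →
             ∀ N (S : VSet n) → size S ≤ N → 1 ≤ size S → Sparse G c S
sparse-all G c noDense zero S |S|≤0 1≤|S| = contradiction (≤-trans 1≤|S| |S|≤0) λ ()
sparse-all G c noDense (suc N) S |S|≤1+N 1≤|S| with size S ≤? 1
... | yes |S|≤1 rewrite ≤-antisym |S|≤1 1≤|S| | edgesIn-≤1 G S |S|≤1 = ≤-reflexive (sym (*-identityʳ c))
-- |S| ≥ 2: if S were not sparse, every cut of G[S] would have at least c
-- edges, contradicting the hypothesis; sparsity is decidable, so S is sparse.
... | no |S|≰1 = decidable-stable (_ ≤? _) λ notSparse →
                   noDense S (≰⇒> |S|≰1) λ T bip → cut-large T bip notSparse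
  where
  sparse-from-cut : ∀ T → IsBipartition S T → cutIn G S T ≤ c → Sparse G c S
  sparse-from-cut T ((v , v∈S∩T) , (w , w∈S∖T)) cut≤c =
    sparse-glue G c S T cut≤c
      (sparse-all G c noDense N (S ∩ T) (part-smaller 1≤|S∖T| parts≤1+N) 1≤|S∩T|)
      (sparse-all G c noDense N (S ∖ T) (part-smaller 1≤|S∩T| (subst (_≤ suc N) (+-comm _ (size (S ∖ T))) parts≤1+N)) 1≤|S∖T|)
    where
    1≤|S∩T| : 1 ≤ size (S ∩ T)
    1≤|S∩T| = size-pos (S ∩ T) v∈S∩T
    1≤|S∖T| : 1 ≤ size (S ∖ T)
    1≤|S∖T| = size-pos (S ∖ T) w∈S∖T
    parts≤1+N : size (S ∩ T) + size (S ∖ T) ≤ suc N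
    parts≤1+N = subst (_≤ suc N) (size-split S T) |S|≤1+N

  cut-large : ∀ T → IsBipartition S T → ¬ Sparse G c S → c ≤ cutIn G S T
  cut-large T bip notSparse with c ≤? cutIn G S T
  ... | yes c≤cut = c≤cut
  ... | no c≰cut  = contradiction (sparse-from-cut T bip (<⇒≤ (≰⇒> c≰cut))) notSparse

sparse-graph : ∀ {n} (G : Multigraph n) c → 1 ≤ n →
               (∀ (S : VSet n) → 2 ≤ size S → ¬ MinCutAtLeast G S c) →
               numEdges G + c ≤ c * n
sparse-graph {n} G c 1≤n noDense =
  subst₂ (λ m |V| → m + c ≤ c * |V|) (edgesIn-full G) (size-full n)
    (sparse-all G c noDense n full (≤-reflexive (size-full n)) (subst (1 ≤_) (sym (size-full n)) 1≤n))

degree : ∀ {n} → Multigraph n → Fin n → ℕ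
degree G v = cutIn G full (singleton v)

∑-const-0 : ∀ n → ∑[ v < n ] 0 ≡ 0
∑-const-0 zero    = refl
∑-const-0 (suc n) = ∑-const-0 n

∑-singleton : ∀ {n} (a : Fin n) → ∑[ v < n ] ind (does (a ≟ v)) ≡ 1
∑-singleton {suc n} Fin.zero    = cong suc (∑-const-0 n)
∑-singleton {suc n} (Fin.suc a) = ∑-singleton a

∑-endpoints : ∀ {n} (a b : Fin n) → a ≢ b → ∑[ v < n ] ind (does (a ≟ v) xor does (b ≟ v)) ≡ 2
∑-endpoints {n} a b a≢b = begin
  ∑[ v < n ] ind (does (a ≟ v) xor does (b ≟ v))          ≡⟨ sum-cong-≗ (λ v → xor-disjoint (a ≟ v) (b ≟ v)) ⟩
  ∑[ v < n ] (ind (does (a ≟ v)) + ind (does (b ≟ v)))    ≡⟨ ∑-distrib-+ {n} (λ v → ind (does (a ≟ v))) (λ v → ind (does (b ≟ v))) ⟩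
  ∑[ v < n ] ind (does (a ≟ v)) + ∑[ v < n ] ind (does (b ≟ v)) ≡⟨ cong₂ _+_ (∑-singleton a) (∑-singleton b) ⟩
  2                                                        ∎
  where
  open ≡-Reasoning
  xor-disjoint : ∀ {v} (a≟v : Dec (a ≡ v)) (b≟v : Dec (b ≡ v)) →
                 ind (does a≟v xor does b≟v) ≡ ind (does a≟v) + ind (does b≟v)
  xor-disjoint (yes a≡v) (yes b≡v) = contradiction (trans a≡v (sym b≡v)) a≢b
  xor-disjoint (yes _)   (no _)    = refl
  xor-disjoint (no _)    (yes _)   = refl
  xor-disjoint (no _)    (no _)    = refl

handshake : ∀ {n} (G : Multigraph n) → ∑[ v < n ] degree G v ≡ 2 * numEdges G
handshake {n} G = degree-sum (edges G) (loopless G)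
  where
  incident : Fin n → Fin n × Fin n → Bool
  incident v e = does (proj₁ e ≟ v) xor does (proj₂ e ≟ v)
  degree-sum : ∀ es → All (λ e → proj₁ e ≢ proj₂ e) es → ∑[ v < n ] count (incident v) es ≡ 2 * length es
  degree-sum []       []          = ∑-const-0 n
  degree-sum (e ∷ es) (e≢ ∷ rest) = begin
    ∑[ v < n ] count (incident v) (e ∷ es)                           ≡⟨ sum-cong-≗ (λ v → count-∷ (incident v) e es) ⟩
    ∑[ v < n ] (ind (incident v e) + count (incident v) es)          ≡⟨ ∑-distrib-+ {n} (λ v → ind (incident v e)) (λ v → count (incident v) es) ⟩
    ∑[ v < n ] ind (incident v e) + ∑[ v < n ] count (incident v) es ≡⟨ cong₂ _+_ (∑-endpoints _ _ e≢) (degree-sum es rest) ⟩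
    2 + 2 * length es                                                ≡⟨ sym (*-distribˡ-+ 2 1 (length es)) ⟩
    2 * length (e ∷ es)                                              ∎
    where open ≡-Reasoning

∑-lower : ∀ {n} k (f : Fin n → ℕ) → (∀ v → k ≤ f v) → n * k ≤ ∑[ v < n ] f v
∑-lower {zero}  k f k≤f = z≤n
∑-lower {suc n} k f k≤f = +-mono-≤ (k≤f Fin.zero) (∑-lower k (λ v → f (Fin.suc v)) (λ v → k≤f (Fin.suc v)))

degree-lower-bound : ∀ {n} (G : Multigraph n) k → 2 ≤ n → MinCutAtLeast G full k → n * k ≤ 2 * numEdges G
degree-lower-bound {n} G k 2≤n minCut≥k =
  ≤-trans (∑-lower k (degree G) (λ v → minCut≥k (singleton v) ((v , dec-true (v ≟ v) refl) , another v 2≤n)))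
          (≤-reflexive (handshake G))
  where
  another : ∀ {m} (v : Fin m) → 2 ≤ m → ∃[ u ] (full u ∧ not (singleton v u) ≡ true)
  another Fin.zero    (s≤s (s≤s _)) = Fin.suc Fin.zero , refl
  another (Fin.suc v) (s≤s (s≤s _)) = Fin.zero , refl

corollary3p9 : ∃[ a ] ∃[ b ] ((n : ℕ) (G : Multigraph n) (k : ℕ) → 2 ≤ n → 1 ≤ k → MinCutValue G k
    → (∀ (S : VSet n) → 2 ≤ size S → ¬ MinCutAtLeast G S (2 * k))
    → (n * k ≤ a * numEdges G) × (numEdges G ≤ b * (n * k)))
corollary3p9 = 2 , 2 , λ n G k 2≤n _ (minCut≥k , _) noDense →
  degree-lower-bound G k 2≤n minCut≥k ,
  (begin
    numEdges G          ≤⟨ m≤m+n _ (2 * k) ⟩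
    numEdges G + 2 * k  ≤⟨ sparse-graph G (2 * k) (≤-trans (s≤s z≤n) 2≤n) noDense ⟩
    2 * k * n           ≡⟨ reorder k n ⟩
    2 * (n * k)         ∎)
  where
  open ≤-Reasoning
  reorder : ∀ k n → 2 * k * n ≡ 2 * (n * k)
  reorder = solve-∀
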